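{- If $G$ is a connected graph on at least three vertices, then $\gamma^{\mathrm{L}}(G)\leq\gamma_t^{\mathrm{L}}(G)\leq 2\gamma^{\mathrm{L}}(G)-1$.
   Context: All graphs are finite, simple and undirected. $N[v]$ is the closed neighbourhood of $v$; for $C\subseteq V(G)$, $I(v)=N[v]\cap C$. A locating-dominating set is a dominating set $C$ such that $I(u)\neq I(v)$ for all distinct $u,v\notin C$; $\gamma^{\mathrm{L}}(G)$ is its minimum size. A locating-total dominating set is a locating-dominating set $C$ such that every vertex of $G$ has a neighbour in $C$; $\gamma_t^{\mathrm{L}}(G)$ is its minimum size. -}

module Defs where

open import Data.Nat using (ℕ; _≤_)
open import Data.Bool using (Bool; true; false; _∨_)
open import Data.Fin using (Fin)
open import Data.Fin.Properties using (_≟_)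
open import Data.Fin.Subset using (Subset; _∈_; _∉_; _∩_; ∣_∣; Nonempty)
open import Data.Vec using (tabulate)
open import Data.Product using (Σ; ∃; _×_)
open import Relation.Binary.PropositionalEquality using (_≡_; _≢_)
open import Relation.Nullary.Decidable using (⌊_⌋)

record Graph : Set where
  field
    n      : ℕ
    adj    : Fin n → Fin n → Bool
    sym    : ∀ u v → adj u v ≡ adj v u
    irrefl : ∀ v → adj v v ≡ false
open Graph public

data Walk (G : Graph) : Fin (n G) → Fin (n G) → Set where
  here : ∀ {u} → Walk G u u
  step : ∀ {u w v} → adj G u w ≡ true → Walk G w v → Walk G u v

Connected : Graph → Set
Connected G = ∀ u v → Walk G u v

N[_] : {G : Graph} → Fin (n G) → Subset (n G)
N[_] {G} v = tabulate (λ u → ⌊ u ≟ v ⌋ ∨ adj G u v)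

I : (G : Graph) → Subset (n G) → Fin (n G) → Subset (n G)
I G C v = N[_] {G} v ∩ C

IsDominating : (G : Graph) → Subset (n G) → Set
IsDominating G C = ∀ v → Nonempty (I G C v)

IsLocatingDominating : (G : Graph) → Subset (n G) → Set
IsLocatingDominating G C =
  IsDominating G C ×
  (∀ u v → u ∉ C → v ∉ C → u ≢ v → I G C u ≢ I G C v)

IsLocatingTotalDominating : (G : Graph) → Subset (n G) → Set
IsLocatingTotalDominating G C =
  IsLocatingDominating G C ×
  (∀ v → ∃ λ u → (u ∈ C) × (adj G v u ≡ true))

IsMinSize : (G : Graph) → (Subset (n G) → Set) → ℕ → Set
IsMinSize G P k =
  (Σ (Subset (n G)) λ C → P C × ∣ C ∣ ≡ k) ×
  (∀ C → P C → k ≤ ∣ C ∣)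

γL≡ : Graph → ℕ → Set
γL≡ G = IsMinSize G (IsLocatingDominating G)

γtL≡ : Graph → ℕ → Set
γtL≡ G = IsMinSize G (IsLocatingTotalDominating G)

-- Every locating-total dominating set is locating-dominating, which gives the lower bound.
-- For the upper bound take a minimum locating-dominating set C and a neighbour h x of every
-- vertex x (connectivity on at least two vertices).  Supersets of C stay locating-dominating,
-- so C ∪ h(C) is a locating-total dominating set of size at most 2|C|.  If two vertices of C
-- are adjacent or have a common neighbour w, both already have a neighbour in C ∪ {w}, and
-- leaving them out of the domain of h saves one vertex.  Otherwise every vertex outside C has
-- exactly one neighbour in C, so by the locating property V ∖ C ⊆ h(C), and V ∖ C is itself a
-- locating-total dominating set: a vertex outside C without a neighbour outside C would form,
-- with its C-neighbour, a component of two vertices, impossible in a connected graph of order ≥ 3.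
module Submission where

open import Defs hiding (sym)
open import Data.Bool using (true; _∨_)
open import Data.Bool.Properties using () renaming (_≟_ to _≟ᵇ_)
open import Data.Empty using (⊥; ⊥-elim)
open import Data.Fin using (Fin; zero; suc; punchIn; punchOut; fromℕ<)
open import Data.Fin.Properties using (_≟_; any?; punchInᵢ≢i; punchIn-injective; punchIn-punchOut)
open import Data.Fin.Subset using (Subset; _∈_; _∉_; _∩_; _∪_; _⊆_; _-_; ⁅_⁆; ∁; ∣_∣; inside; outside) renaming (⊥ to ∅)
open import Data.Fin.Subset.Properties
  using (_∈?_; ⊆-antisym; x∈p∩q⁺; x∈p∩q⁻; x∈p∪q⁺; x∈⁅x⁆; x∈⁅y⁆⇒x≡y; ∣⁅x⁆∣≡1; ∣⊥∣≡0;
         p⊆p∪q; q⊆p∪q; p⊆q⇒∣p∣≤∣q∣; x∈p∧x≢y⇒x∈p-y; x∈p⇒∣p-x∣<∣p∣;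
         x∈∁p⇒x∉p; x∉∁p⇒x∈p; x∉p⇒x∈∁p)
open import Data.Nat using (ℕ; suc; _≤_; _<_; _+_; _*_; _∸_; z≤n; s≤s)
open import Data.Nat.Properties
  using (≤-reflexive; ≤-trans; +-suc; +-assoc; +-identityʳ; +-monoʳ-≤; +-monoʳ-<; +-mono-≤; *-identityˡ;
         suc[m]≤n⇒m≤pred[n]; pred[m∸n]≡m∸[1+n]; n≤1+n; module ≤-Reasoning)
open import Data.Product using (_×_; _,_; ∃; ∃₂; proj₁; proj₂)
open import Data.Sum using (_⊎_; inj₁; inj₂)
open import Data.Vec using (_∷_; []; here; there)
open import Data.Vec.Properties using ([]=⇒lookup; lookup⇒[]=; lookup∘tabulate)
open import Function using (_∘_)
open import Relation.Nullary using (¬_; Dec; yes; no; contradiction)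
open import Relation.Nullary.Decidable using (⌊_⌋; _×-dec_; ¬?)
open import Relation.Binary.PropositionalEquality using (_≡_; _≢_; refl; sym; trans; cong; subst; module ≡-Reasoning)

∣p∪q∣≤∣p∣+∣q∣ : ∀ {m} (p q : Subset m) → ∣ p ∪ q ∣ ≤ ∣ p ∣ + ∣ q ∣
∣p∪q∣≤∣p∣+∣q∣ []            []            = z≤n
∣p∪q∣≤∣p∣+∣q∣ (outside ∷ p) (outside ∷ q) = ∣p∪q∣≤∣p∣+∣q∣ p q
∣p∪q∣≤∣p∣+∣q∣ (outside ∷ p) (inside ∷ q)  =
  ≤-trans (s≤s (∣p∪q∣≤∣p∣+∣q∣ p q)) (≤-reflexive (sym (+-suc ∣ p ∣ ∣ q ∣)))
∣p∪q∣≤∣p∣+∣q∣ (inside ∷ p)  (outside ∷ q) = s≤s (∣p∪q∣≤∣p∣+∣q∣ p q)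
∣p∪q∣≤∣p∣+∣q∣ (inside ∷ p)  (inside ∷ q)  =
  s≤s (≤-trans (∣p∪q∣≤∣p∣+∣q∣ p q) (+-monoʳ-≤ ∣ p ∣ (n≤1+n ∣ q ∣)))

image : ∀ {m k} → (Fin m → Fin k) → Subset m → Subset k
image f []            = ∅
image f (outside ∷ p) = image (f ∘ suc) p
image f (inside ∷ p)  = ⁅ f zero ⁆ ∪ image (f ∘ suc) p

∈-image⁺ : ∀ {m k} (f : Fin m → Fin k) {p x} → x ∈ p → f x ∈ image f p
∈-image⁺ f {inside ∷ p}  here      = x∈p∪q⁺ (inj₁ (x∈⁅x⁆ (f zero)))
∈-image⁺ f {outside ∷ p} (there x∈p) = ∈-image⁺ (f ∘ suc) x∈p
∈-image⁺ f {inside ∷ p}  (there x∈p) = x∈p∪q⁺ (inj₂ (∈-image⁺ (f ∘ suc) x∈p))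

∣image∣≤∣p∣ : ∀ {m k} (f : Fin m → Fin k) (p : Subset m) → ∣ image f p ∣ ≤ ∣ p ∣
∣image∣≤∣p∣ {k = k} f []    = ≤-reflexive (∣⊥∣≡0 k)
∣image∣≤∣p∣ f (outside ∷ p) = ∣image∣≤∣p∣ (f ∘ suc) p
∣image∣≤∣p∣ f (inside ∷ p)  = begin
  ∣ ⁅ f zero ⁆ ∪ image (f ∘ suc) p ∣     ≤⟨ ∣p∪q∣≤∣p∣+∣q∣ ⁅ f zero ⁆ _ ⟩
  ∣ ⁅ f zero ⁆ ∣ + ∣ image (f ∘ suc) p ∣  ≡⟨ cong (_+ ∣ image (f ∘ suc) p ∣) (∣⁅x⁆∣≡1 (f zero)) ⟩
  suc ∣ image (f ∘ suc) p ∣               ≤⟨ s≤s (∣image∣≤∣p∣ (f ∘ suc) p) ⟩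
  suc ∣ p ∣                               ∎
  where open ≤-Reasoning

∩-restrict : ∀ {m} {a c d : Subset m} → c ⊆ d → (a ∩ d) ∩ c ≡ a ∩ c
∩-restrict {a = a} {c} {d} c⊆d = ⊆-antisym forget keep
  where
  forget : (a ∩ d) ∩ c ⊆ a ∩ c
  forget x∈ with x∈p∩q⁻ (a ∩ d) c x∈
  ... | x∈a∩d , x∈c = x∈p∩q⁺ (proj₁ (x∈p∩q⁻ a d x∈a∩d) , x∈c)
  keep : a ∩ c ⊆ (a ∩ d) ∩ c
  keep x∈ with x∈p∩q⁻ a c x∈
  ... | x∈a , x∈c = x∈p∩q⁺ (x∈p∩q⁺ (x∈a , c⊆d x∈c) , x∈c)

m≤2*a∸1 : ∀ {m a k} → m ≤ a + k → k < a → m ≤ 2 * a ∸ 1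
m≤2*a∸1 {m} {a} {k} m≤a+k k<a =
  ≤-trans (suc[m]≤n⇒m≤pred[n] m<2a) (≤-reflexive (pred[m∸n]≡m∸[1+n] (2 * a) 0))
  where
  open ≤-Reasoning
  m<2a : m < 2 * a
  m<2a = begin-strict
    m         ≤⟨ m≤a+k ⟩
    a + k     <⟨ +-monoʳ-< a k<a ⟩
    a + a     ≡⟨ cong (a +_) (sym (*-identityˡ a)) ⟩
    2 * a     ∎

avoid-one : ∀ {m} → 2 ≤ m → (x : Fin m) → ∃ λ y → y ≢ x
avoid-one (s≤s (s≤s _)) x = punchIn x zero , punchInᵢ≢i x zero

avoid-two : ∀ {m} → 3 ≤ m → (u v : Fin m) → ∃ λ z → z ≢ u × z ≢ v
avoid-two 3≤m u v with v ≟ u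
... | yes refl = let z , z≢u = avoid-one (≤-trans (n≤1+n 2) 3≤m) u in z , z≢u , z≢u
avoid-two (s≤s (s≤s (s≤s _))) u v | no v≢u = punchIn u j , punchInᵢ≢i u j , j≢v
  where
  u≢v = v≢u ∘ sym
  j = punchIn (punchOut u≢v) zero
  j≢v : punchIn u j ≢ v
  j≢v eq = punchInᵢ≢i (punchOut u≢v) zero
    (punchIn-injective u j _ (trans eq (sym (punchIn-punchOut u≢v))))

Vertex : Graph → Set
Vertex G = Fin (n G)

HasNeighbourIn : (G : Graph) → Subset (n G) → Vertex G → Set
HasNeighbourIn G S v = ∃ λ u → u ∈ S × adj G v u ≡ true

EdgeWithin : (G : Graph) → Subset (n G) → Set
EdgeWithin G C = ∃₂ λ c₀ c₁ → c₀ ∈ C × c₁ ∈ C × adj G c₀ c₁ ≡ true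

SharedNeighbour : (G : Graph) → Subset (n G) → Set
SharedNeighbour G C =
  ∃₂ λ c₀ c₁ → c₀ ∈ C × c₁ ∈ C × c₀ ≢ c₁ × ∃ λ w → adj G c₀ w ≡ true × adj G c₁ w ≡ true

edgeWithin? : ∀ G C → Dec (EdgeWithin G C)
edgeWithin? G C = any? λ c₀ → any? λ c₁ → c₀ ∈? C ×-dec c₁ ∈? C ×-dec adj G c₀ c₁ ≟ᵇ true

sharedNeighbour? : ∀ G C → Dec (SharedNeighbour G C)
sharedNeighbour? G C = any? λ c₀ → any? λ c₁ → c₀ ∈? C ×-dec c₁ ∈? C ×-dec ¬? (c₀ ≟ c₁) ×-dec
  any? λ w → adj G c₀ w ≟ᵇ true ×-dec adj G c₁ w ≟ᵇ true

module _ (G : Graph) where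

  adj-sym : ∀ {u v} → adj G u v ≡ true → adj G v u ≡ true
  adj-sym {u} {v} e = trans (Graph.sym G v u) e

  adj⇒≢ : ∀ {u v} → adj G u v ≡ true → u ≢ v
  adj⇒≢ {u} e refl with trans (sym e) (irrefl G u)
  ... | ()

  ∈N[]⁻ : ∀ {u v} → u ∈ N[_] {G} v → u ≡ v ⊎ adj G u v ≡ true
  ∈N[]⁻ {u} {v} u∈N with u ≟ v | trans (sym (lookup∘tabulate _ u)) ([]=⇒lookup u∈N)
  ... | yes u≡v | _   = inj₁ u≡v
  ... | no _    | uv  = inj₂ uv

  ∈N[]⁺ : ∀ {u v} → u ≡ v ⊎ adj G u v ≡ true → u ∈ N[_] {G} v
  ∈N[]⁺ {u} {v} close = lookup⇒[]= u _ (trans (lookup∘tabulate _ u) (member (u ≟ v) close))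
    where
    member : (d : Dec (u ≡ v)) → u ≡ v ⊎ adj G u v ≡ true → ⌊ d ⌋ ∨ adj G u v ≡ true
    member (yes _)   _           = refl
    member (no u≢v)  (inj₁ u≡v)  = contradiction u≡v u≢v
    member (no _)    (inj₂ uv)   = uv

  ∈I⁻ : ∀ {C u v} → u ∈ I G C v → u ∈ C × (u ≡ v ⊎ adj G u v ≡ true)
  ∈I⁻ {C} {u} {v} u∈I with x∈p∩q⁻ (N[_] {G} v) C u∈I
  ... | u∈N , u∈C = u∈C , ∈N[]⁻ u∈N

  ∈I⁺ : ∀ {C u v} → u ∈ C → u ≡ v ⊎ adj G u v ≡ true → u ∈ I G C v
  ∈I⁺ u∈C close = x∈p∩q⁺ (∈N[]⁺ close , u∈C)

  walk-preserves : (P : Vertex G → Set) → (∀ {a b} → adj G a b ≡ true → P a → P b) →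
                   ∀ {x y} → Walk G x y → P x → P y
  walk-preserves P closed here          px = px
  walk-preserves P closed (step ab walk) pa = walk-preserves P closed walk (closed ab pa)

  module _ (conn : Connected G) where

    neighbour : 2 ≤ n G → ∀ x → ∃ λ y → adj G x y ≡ true
    neighbour 2≤n x with avoid-one 2≤n x
    ... | y , y≢x = first-step (conn x y) (y≢x ∘ sym)
      where
      first-step : ∀ {y} → Walk G x y → x ≢ y → ∃ λ w → adj G x w ≡ true
      first-step here         x≢x = contradiction refl x≢x
      first-step (step xw _)  _   = _ , xw

    no-isolated-edge : 3 ≤ n G → ∀ u v → (∀ {b} → adj G u b ≡ true → b ≡ v) →
                       (∀ {b} → adj G v b ≡ true → b ≡ u) → ⊥
    no-isolated-edge 3≤n u v only-v only-u with avoid-two 3≤n u v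
    ... | z , z≢u , z≢v with walk-preserves (λ x → x ≡ u ⊎ x ≡ v) closed (conn u z) (inj₁ refl)
      where
      closed : ∀ {a b} → adj G a b ≡ true → a ≡ u ⊎ a ≡ v → b ≡ u ⊎ b ≡ v
      closed ab (inj₁ refl) = inj₂ (only-v ab)
      closed ab (inj₂ refl) = inj₁ (only-u ab)
    ... | inj₁ z≡u = z≢u z≡u
    ... | inj₂ z≡v = z≢v z≡v

  total⇒dominating : ∀ {D} → (∀ v → HasNeighbourIn G D v) → IsDominating G D
  total⇒dominating total v with total v
  ... | u , u∈D , vu = u , ∈I⁺ u∈D (inj₂ (adj-sym vu))

module _ (G : Graph) {C : Subset (n G)} (ld : IsLocatingDominating G C) where

  dominator : ∀ {v} → v ∉ C → ∃ λ u → u ∈ C × adj G u v ≡ true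
  dominator {v} v∉C with proj₁ ld v
  ... | u , u∈I with ∈I⁻ G u∈I
  ... | u∈C , inj₁ refl = contradiction u∈C v∉C
  ... | u∈C , inj₂ uv   = u , u∈C , uv

  1≤∣C∣ : Vertex G → 1 ≤ ∣ C ∣
  1≤∣C∣ v with proj₁ ld v
  ... | u , u∈I = ≤-trans (s≤s z≤n) (x∈p⇒∣p-x∣<∣p∣ (proj₁ (∈I⁻ G u∈I)))

  ⊆-isLocatingDominating : ∀ {D} → C ⊆ D → IsLocatingDominating G D
  ⊆-isLocatingDominating {D} C⊆D = dominating , locating
    where
    dominating : IsDominating G D
    dominating v with proj₁ ld v
    ... | u , u∈I with ∈I⁻ G u∈I
    ... | u∈C , close = u , ∈I⁺ G (C⊆D u∈C) close
    locating : ∀ u v → u ∉ D → v ∉ D → u ≢ v → I G D u ≢ I G D v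
    locating u v u∉D v∉D u≢v same = proj₂ ld u v (u∉D ∘ C⊆D) (v∉D ∘ C⊆D) u≢v (begin
      I G C u       ≡⟨ sym (∩-restrict C⊆D) ⟩
      I G D u ∩ C   ≡⟨ cong (_∩ C) same ⟩
      I G D v ∩ C   ≡⟨ ∩-restrict C⊆D ⟩
      I G C v       ∎)
      where open ≡-Reasoning

  ⊆-isLocatingTotalDominating : ∀ {D} → C ⊆ D →
    (∀ {c} → c ∈ C → HasNeighbourIn G D c) → IsLocatingTotalDominating G D
  ⊆-isLocatingTotalDominating {D} C⊆D served = ⊆-isLocatingDominating C⊆D , total
    where
    total : ∀ v → HasNeighbourIn G D v
    total v with v ∈? C
    ... | yes v∈C = served v∈C
    ... | no v∉C with dominator v∉C
    ...   | u , u∈C , uv = u , C⊆D u∈C , adj-sym G uv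

module Construction (G : Graph) (conn : Connected G) (3≤n : 3 ≤ n G)
                    {C : Subset (n G)} (ld : IsLocatingDominating G C) where

  SmallLTD : Set
  SmallLTD = ∃ λ D → IsLocatingTotalDominating G D × ∣ D ∣ ≤ 2 * ∣ C ∣ ∸ 1

  private
    h : Vertex G → Vertex G
    h x = proj₁ (neighbour G conn (≤-trans (n≤1+n 2) 3≤n) x)

    x~hx : ∀ x → adj G x (h x) ≡ true
    x~hx x = proj₂ (neighbour G conn (≤-trans (n≤1+n 2) 3≤n) x)

  pair-served : ∀ {c₀ c₁ w} → c₀ ∈ C → c₁ ∈ C → c₀ ≢ c₁ →
    HasNeighbourIn G (C ∪ ⁅ w ⁆) c₀ → HasNeighbourIn G (C ∪ ⁅ w ⁆) c₁ → SmallLTD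
  pair-served {c₀} {c₁} {w} c₀∈C c₁∈C c₀≢c₁ served₀ served₁ =
    D , ⊆-isLocatingTotalDominating G ld (C∪w⊆D ∘ p⊆p∪q ⁅ w ⁆) served , m≤2*a∸1 size rest+1<∣C∣
    where
    rest = C - c₀ - c₁
    C∪w = C ∪ ⁅ w ⁆
    D = C∪w ∪ image h rest

    C∪w⊆D : C∪w ⊆ D
    C∪w⊆D = p⊆p∪q (image h rest)

    lift : ∀ {c} → HasNeighbourIn G C∪w c → HasNeighbourIn G D c
    lift (u , u∈ , cu) = u , C∪w⊆D u∈ , cu

    served : ∀ {c} → c ∈ C → HasNeighbourIn G D c
    served {c} c∈C with c ≟ c₀ | c ≟ c₁
    ... | yes refl | _        = lift served₀
    ... | no _     | yes refl = lift served₁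
    ... | no c≢c₀  | no c≢c₁  =
      h c , q⊆p∪q _ _ (∈-image⁺ h (x∈p∧x≢y⇒x∈p-y (x∈p∧x≢y⇒x∈p-y c∈C c≢c₀) c≢c₁)) , x~hx c

    size : ∣ D ∣ ≤ ∣ C ∣ + suc ∣ rest ∣
    size = begin
      ∣ D ∣                            ≤⟨ ∣p∪q∣≤∣p∣+∣q∣ C∪w (image h rest) ⟩
      ∣ C∪w ∣ + ∣ image h rest ∣       ≤⟨ +-mono-≤ (∣p∪q∣≤∣p∣+∣q∣ C ⁅ w ⁆) (∣image∣≤∣p∣ h rest) ⟩
      (∣ C ∣ + ∣ ⁅ w ⁆ ∣) + ∣ rest ∣   ≡⟨ cong (λ k → (∣ C ∣ + k) + ∣ rest ∣) (∣⁅x⁆∣≡1 w) ⟩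
      (∣ C ∣ + 1) + ∣ rest ∣           ≡⟨ +-assoc (∣ C ∣) 1 (∣ rest ∣) ⟩
      ∣ C ∣ + suc ∣ rest ∣             ∎
      where open ≤-Reasoning

    rest+1<∣C∣ : suc ∣ rest ∣ < ∣ C ∣
    rest+1<∣C∣ = ≤-trans (s≤s (x∈p⇒∣p-x∣<∣p∣ (x∈p∧x≢y⇒x∈p-y c₁∈C (c₀≢c₁ ∘ sym)))) (x∈p⇒∣p-x∣<∣p∣ c₀∈C)

  from-edge : EdgeWithin G C → SmallLTD
  from-edge (c₀ , c₁ , c₀∈C , c₁∈C , c₀c₁) = pair-served {w = c₀} c₀∈C c₁∈C (adj⇒≢ G c₀c₁)
    (c₁ , p⊆p∪q _ c₁∈C , c₀c₁) (c₀ , p⊆p∪q _ c₀∈C , adj-sym G c₀c₁)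

  from-shared : SharedNeighbour G C → SmallLTD
  from-shared (c₀ , c₁ , c₀∈C , c₁∈C , c₀≢c₁ , w , c₀w , c₁w) =
    pair-served c₀∈C c₁∈C c₀≢c₁ (w , w∈ , c₀w) (w , w∈ , c₁w)
    where
    w∈ = q⊆p∪q C ⁅ w ⁆ (x∈⁅x⁆ w)

  module Sparse (independent : ¬ EdgeWithin G C) (apart : ¬ SharedNeighbour G C) where

    h∉C : ∀ {c} → c ∈ C → h c ∉ C
    h∉C {c} c∈C hc∈C = independent (c , h c , c∈C , hc∈C , x~hx c)

    I≡⁅dominator⁆ : ∀ {u x} → u ∈ C → x ∉ C → adj G u x ≡ true → I G C x ≡ ⁅ u ⁆
    I≡⁅dominator⁆ {u} {x} u∈C x∉C ux = ⊆-antisym only-u u∈I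
      where
      only-u : I G C x ⊆ ⁅ u ⁆
      only-u {y} y∈I with ∈I⁻ G y∈I
      ... | y∈C , inj₁ refl = contradiction y∈C x∉C
      ... | y∈C , inj₂ yx with y ≟ u
      ...   | yes refl = x∈⁅x⁆ u
      ...   | no y≢u   = contradiction (y , u , y∈C , u∈C , y≢u , x , yx , ux) apart
      u∈I : ⁅ u ⁆ ⊆ I G C x
      u∈I y∈⁅u⁆ with x∈⁅y⁆⇒x≡y u y∈⁅u⁆
      ... | refl = ∈I⁺ G u∈C (inj₂ ux)

    outside-neighbour≡h : ∀ {u x} → u ∈ C → x ∉ C → adj G u x ≡ true → x ≡ h u
    outside-neighbour≡h {u} {x} u∈C x∉C ux with x ≟ h u
    ... | yes x≡hu = x≡hu
    ... | no x≢hu  = contradiction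
      (trans (I≡⁅dominator⁆ u∈C x∉C ux) (sym (I≡⁅dominator⁆ u∈C (h∉C u∈C) (x~hx u))))
      (proj₂ ld x (h u) x∉C (h∉C u∈C) x≢hu)

    ∁C⊆image : ∁ C ⊆ image h C
    ∁C⊆image x∈∁C with dominator G ld (x∈∁p⇒x∉p x∈∁C)
    ... | u , u∈C , ux with outside-neighbour≡h u∈C (x∈∁p⇒x∉p x∈∁C) ux
    ...   | refl = ∈-image⁺ h u∈C

    outside-served : ∀ {v} → v ∉ C → HasNeighbourIn G (∁ C) v
    outside-served {v} v∉C with dominator G ld v∉C | any? (λ y → ¬? (y ∈? C) ×-dec adj G v y ≟ᵇ true)
    ... | _            | yes (y , y∉C , vy) = y , x∉p⇒x∈∁p y∉C , vy
    ... | u , u∈C , uv | no none            = ⊥-elim (no-isolated-edge G conn 3≤n u v only-v only-u)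
      where
      only-u : ∀ {b} → adj G v b ≡ true → b ≡ u
      only-u {b} vb with b ∈? C
      ... | no b∉C = contradiction (b , b∉C , vb) none
      ... | yes b∈C with b ≟ u
      ...   | yes b≡u = b≡u
      ...   | no b≢u  = contradiction (b , u , b∈C , u∈C , b≢u , v , adj-sym G vb , uv) apart
      only-v : ∀ {b} → adj G u b ≡ true → b ≡ v
      only-v {b} ub with b ∈? C
      ... | yes b∈C = contradiction (u , b , u∈C , b∈C , ub) independent
      ... | no b∉C  = trans (outside-neighbour≡h u∈C b∉C ub) (sym (outside-neighbour≡h u∈C v∉C uv))

    h-private : ∀ {u v} → u ∈ C → v ∈ C → u ≢ v → h u ∉ I G (∁ C) v
    h-private {u} {v} u∈C v∈C u≢v hu∈I with ∈I⁻ G hu∈I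
    ... | _ , inj₁ refl = h∉C u∈C v∈C
    ... | _ , inj₂ hu-v = apart (u , v , u∈C , v∈C , u≢v , h u , x~hx u , adj-sym G hu-v)

    ∁C-isLocatingTotalDominating : IsLocatingTotalDominating G (∁ C)
    ∁C-isLocatingTotalDominating = (total⇒dominating G served , locating) , served
      where
      served : ∀ v → HasNeighbourIn G (∁ C) v
      served v with v ∈? C
      ... | yes v∈C = h v , x∉p⇒x∈∁p (h∉C v∈C) , x~hx v
      ... | no v∉C  = outside-served v∉C
      locating : ∀ u v → u ∉ ∁ C → v ∉ ∁ C → u ≢ v → I G (∁ C) u ≢ I G (∁ C) v
      locating u v u∉∁C v∉∁C u≢v same = h-private u∈C (x∉∁p⇒x∈p v∉∁C) u≢v
        (subst (h u ∈_) same (∈I⁺ G (x∉p⇒x∈∁p (h∉C u∈C)) (inj₂ (adj-sym G (x~hx u)))))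
        where
        u∈C = x∉∁p⇒x∈p u∉∁C

    ∁C-small : SmallLTD
    ∁C-small = ∁ C , ∁C-isLocatingTotalDominating , m≤2*a∸1 size (1≤∣C∣ G ld (fromℕ< (≤-trans (s≤s z≤n) 3≤n)))
      where
      size : ∣ ∁ C ∣ ≤ ∣ C ∣ + 0
      size = ≤-trans (p⊆q⇒∣p∣≤∣q∣ ∁C⊆image)
               (≤-trans (∣image∣≤∣p∣ h C) (≤-reflexive (sym (+-identityʳ ∣ C ∣))))

  smallLTD : SmallLTD
  smallLTD with edgeWithin? G C | sharedNeighbour? G C
  ... | yes edge        | _             = from-edge edge
  ... | no _            | yes shared    = from-shared shared
  ... | no independent  | no apart      = Sparse.∁C-small independent apart

theorem19 : (G : Graph) → Connected G → 3 ≤ n G →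
    (a b : ℕ) → γL≡ G a → γtL≡ G b →
    (a ≤ b) × (b ≤ 2 * a ∸ 1)
theorem19 G conn 3≤n _ _ ((C , ld , refl) , least) ((T , ltd , refl) , least-total)
  with Construction.smallLTD G conn 3≤n ld
... | D , D-ltd , ∣D∣≤ = least T (proj₁ ltd) , ≤-trans (least-total D D-ltd) ∣D∣≤
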